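{- Let $\ell \geq 1$, let $\tilde c : 2^{<\omega} \to \ell$ be a coloring and let $\rho \in 2^{<\omega}$. For any $P \subseteq \{0,\dots,|\rho|-1\}$ such that $\rho(n) = 0$ for all $n \in P$ and $|P| \geq \ell$, there exist two subsets $P' < \tilde P$ of $P$ with $\tilde P \neq \emptyset$ such that $\tilde c(\alpha) = \tilde c(\alpha_{\tilde P})$, where $\alpha = \rho_{P'}$.
   Context: For a finite set $F$ and a binary string $\sigma$, $\sigma_F$ is the binary string of length $|\sigma|$ with $\sigma_F(i) = \sigma(i)$ if $i \notin F$ and $\sigma_F(i) = 1 - \sigma(i)$ if $i \in F$. For sets $A,B$, $A < B$ means every element of $A$ is less than every element of $B$ (vacuously true if one is empty). -}

module Defs where

open import Data.Bool using (Bool; true; false; not)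
open import Data.Nat using (ℕ; _<_)
open import Data.Fin using (Fin; toℕ)
open import Data.Fin.Subset using (Subset; _∈_)
open import Data.Vec using (Vec; zipWith)
open import Data.Fin.Subset using (inside; outside)

-- A binary string of length n is a Vec Bool n (false = 0, true = 1).
-- A subset F of the positions {0,…,n-1} is a Subset n (stdlib).
-- σ_F : flip the bits of σ at the positions in F.
flipAt : Bool → Bool → Bool
flipAt true  b = not b
flipAt false b = b

_⟨_⟩ : ∀ {n} → Vec Bool n → Subset n → Vec Bool n
σ ⟨ F ⟩ = zipWith flipAt F σ

_<ˢ_ : ∀ {n} → Subset n → Subset n → Set
A <ˢ B = ∀ {i j} → i ∈ A → j ∈ B → toℕ i < toℕ j

module Submission where

-- Let P_k consist of the first k elements of P (0 ≤ k ≤ ℓ). The ℓ + 1 strings ρ_{P_k} receive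
-- only ℓ colours, so two of them, say for i < j, get the same colour. Then P′ = P_i and
-- P̃ = P_j ∖ P_i satisfy P′ < P̃, P̃ ≠ ∅ and ρ_{P_j} = (ρ_{P′})_{P̃}.

open import Defs
open import Data.Bool using (Bool; false; true; not)
open import Data.Nat using (ℕ; zero; suc; _∸_; _≤_; _<_; _≥_; z≤n; s≤s; z<s; s<s)
open import Data.Nat.Properties using (≤-refl; ≤-trans; <⇒≤)
open import Data.Fin using (Fin; toℕ) renaming (zero to fzero; suc to fsuc)
open import Data.Fin.Properties using (pigeonhole; toℕ≤pred[n])
open import Data.Fin.Subset using (Subset; _∈_; _∉_; _⊆_; ∣_∣; Nonempty)
open import Data.Vec using (Vec; lookup; toList; []; _∷_; here; there)
open import Data.List using (List)
open import Data.Product using (Σ; _×_; _,_)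
open import Data.Empty using (⊥-elim)
open import Relation.Binary.PropositionalEquality using (_≡_; refl; cong; trans)

head∈[_,_⟩ : ℕ → ℕ → Bool
head∈[ zero , suc _ ⟩ = true
head∈[ _    , _     ⟩ = false

-- slice i j P consists of the elements of P whose rank among the elements of P lies in [i, j);
-- passing an element of P shifts the window down by one.
slice : ∀ {n} → ℕ → ℕ → Subset n → Subset n
slice i j []          = []
slice i j (false ∷ P) = false ∷ slice i j P
slice i j (true ∷ P)  = head∈[ i , j ⟩ ∷ slice (i ∸ 1) (j ∸ 1) P

slice⊆ : ∀ {n} i j (P : Subset n) → slice i j P ⊆ P
slice⊆ i j (false ∷ P) (there x∈) = there (slice⊆ i j P x∈)
slice⊆ i j (true ∷ P)  {fzero} _  = here
slice⊆ i j (true ∷ P)  (there x∈) = there (slice⊆ (i ∸ 1) (j ∸ 1) P x∈)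

slice-0-0-empty : ∀ {n} (P : Subset n) {x} → x ∉ slice 0 0 P
slice-0-0-empty (false ∷ P) (there x∈) = slice-0-0-empty P x∈
slice-0-0-empty (true ∷ P)  (there x∈) = slice-0-0-empty P x∈

slice-consecutive-< : ∀ {n} i j (P : Subset n) → slice 0 i P <ˢ slice i j P
slice-consecutive-< i j (false ∷ P) (there x∈) (there y∈) = s<s (slice-consecutive-< i j P x∈ y∈)
slice-consecutive-< zero    j (true ∷ P) {fsuc _} {fzero} (there x∈) _ = ⊥-elim (slice-0-0-empty P x∈)
slice-consecutive-< (suc i) j (true ∷ P) {fzero}  {fsuc _} _ _ = z<s
slice-consecutive-< i j (true ∷ P) (there x∈) (there y∈) =
  s<s (slice-consecutive-< (i ∸ 1) (j ∸ 1) P x∈ y∈)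

slice-nonempty : ∀ {n} i j (P : Subset n) → i < j → j ≤ ∣ P ∣ → Nonempty (slice i j P)
slice-nonempty zero zero [] () _
slice-nonempty (suc _) zero [] () _
slice-nonempty i j (false ∷ P) i<j j≤∣P∣ with slice-nonempty i j P i<j j≤∣P∣
... | x , x∈ = fsuc x , there x∈
slice-nonempty zero (suc j) (true ∷ P) _ _ = fzero , here
slice-nonempty (suc i) (suc j) (true ∷ P) (s<s i<j) (s≤s j≤∣P∣) with slice-nonempty i j P i<j j≤∣P∣
... | x , x∈ = fsuc x , there x∈

flip-prefix-split : ∀ {n} i j (ρ : Vec Bool n) (P : Subset n) → i ≤ j →
  ρ ⟨ slice 0 j P ⟩ ≡ ρ ⟨ slice 0 i P ⟩ ⟨ slice i j P ⟩
flip-prefix-split i j [] [] _ = refl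
flip-prefix-split i j (r ∷ ρ) (false ∷ P) i≤j = cong (r ∷_) (flip-prefix-split i j ρ P i≤j)
flip-prefix-split zero j (r ∷ ρ) (true ∷ P) _ =
  cong (flipAt head∈[ 0 , j ⟩ r ∷_) (flip-prefix-split 0 (j ∸ 1) ρ P z≤n)
flip-prefix-split (suc i) (suc j) (r ∷ ρ) (true ∷ P) (s≤s i≤j) =
  cong (not r ∷_) (flip-prefix-split i j ρ P i≤j)

mainTheorem5 : (ℓ : ℕ) → ℓ ≥ 1 → (c : List Bool → Fin ℓ) →
    (n : ℕ) (ρ : Vec Bool n) (P : Subset n) →
    (∀ i → i ∈ P → lookup ρ i ≡ false) → ∣ P ∣ ≥ ℓ →
    Σ (Subset n) λ P′ → Σ (Subset n) λ P̃ →
    P′ ⊆ P × P̃ ⊆ P × P′ <ˢ P̃ × Nonempty P̃ ×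
    c (toList (ρ ⟨ P′ ⟩)) ≡ c (toList ((ρ ⟨ P′ ⟩) ⟨ P̃ ⟩))
mainTheorem5 ℓ _ c n ρ P _ ℓ≤∣P∣
  with pigeonhole (s≤s ≤-refl) (λ (k : Fin (suc ℓ)) → c (toList (ρ ⟨ slice 0 (toℕ k) P ⟩)))
... | i , j , i<j , same-colour =
  slice 0 (toℕ i) P , slice (toℕ i) (toℕ j) P ,
  slice⊆ _ _ P , slice⊆ _ _ P , slice-consecutive-< _ _ P ,
  slice-nonempty (toℕ i) (toℕ j) P i<j (≤-trans (toℕ≤pred[n] j) ℓ≤∣P∣) ,
  trans same-colour (cong (λ σ → c (toList σ)) (flip-prefix-split (toℕ i) (toℕ j) ρ P (<⇒≤ i<j)))
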